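{- Let $G$ be a connected graph of diameter $2$ that has exactly $k\geq 1$ bridges. Then $rc(G)\leq k+2$.
   Context: All graphs are finite, simple and undirected. A bridge is an edge whose removal disconnects the graph. In an edge-colored graph (adjacent edges may receive the same color), a path is a rainbow path if no two of its edges have the same color. The rainbow connection number $rc(G)$ of a connected graph $G$ is the minimum integer $i$ such that there is an edge-coloring of $G$ with $i$ colors in which every two distinct vertices of $G$ are connected by a rainbow path. -}

module Defs where

open import Data.Nat using (ℕ; zero; suc; _+_; _≤_)
open import Data.Fin using (Fin; _<_)
open import Data.Bool using (Bool; true; false)
open import Data.List using (List; []; _∷_; length)
open import Data.List.Relation.Unary.Unique.Propositional using (Unique)
open import Data.List.Membership.Propositional using (_∈_)
open import Data.Product using (Σ; ∃; ∃-syntax; _×_; _,_)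
open import Data.Sum using (_⊎_)
open import Relation.Nullary using (¬_)
open import Relation.Binary.PropositionalEquality using (_≡_; _≢_)
open import Function.Bundles using (_⇔_)

record Graph (n : ℕ) : Set where
  field
    adj   : Fin n → Fin n → Bool
    sym   : ∀ u v → adj u v ≡ adj v u
    irrefl : ∀ u → adj u u ≡ false

open Graph public

Adj : ∀ {n} → Graph n → Fin n → Fin n → Set
Adj G u v = adj G u v ≡ true

data Walk {n : ℕ} (R : Fin n → Fin n → Set) : Fin n → Fin n → Set where
  []  : ∀ {u} → Walk R u u
  _∷_ : ∀ {u w v} → R u w → Walk R w v → Walk R u v

vertices : ∀ {n} {R : Fin n → Fin n → Set} {u v} → Walk R u v → List (Fin n)
vertices {u = u} []      = u ∷ []
vertices {u = u} (_ ∷ w) = u ∷ vertices w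

walkLength : ∀ {n} {R : Fin n → Fin n → Set} {u v} → Walk R u v → ℕ
walkLength []      = 0
walkLength (_ ∷ w) = suc (walkLength w)

ConnectedRel : ∀ {n} → (Fin n → Fin n → Set) → Set
ConnectedRel {n} R = ∀ (u v : Fin n) → Walk R u v

Connected : ∀ {n} → Graph n → Set
Connected G = ConnectedRel (Adj G)

Dist : ∀ {n} → Graph n → Fin n → Fin n → ℕ → Set
Dist G u v d =
  Σ (Walk (Adj G) u v) (λ w → walkLength w ≡ d)
  × (∀ (w : Walk (Adj G) u v) → d ≤ walkLength w)

Diameter : ∀ {n} → Graph n → ℕ → Set
Diameter {n} G D =
  (∀ (u v : Fin n) → Σ ℕ (λ d → Dist G u v d × d ≤ D))
  × Σ (Fin n) (λ u → Σ (Fin n) (λ v → Dist G u v D))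

SameEdge : ∀ {n} → Fin n → Fin n → Fin n → Fin n → Set
SameEdge x y u v = (x ≡ u × y ≡ v) ⊎ (x ≡ v × y ≡ u)

AdjMinus : ∀ {n} → Graph n → Fin n → Fin n → Fin n → Fin n → Set
AdjMinus G u v x y = Adj G x y × ¬ SameEdge x y u v

IsBridge : ∀ {n} → Graph n → Fin n → Fin n → Set
IsBridge G u v = Adj G u v × ¬ ConnectedRel (AdjMinus G u v)

-- G has exactly k bridges: there is a duplicate-free list of k pairs (u,v) with u < v
-- which lists precisely the bridges of G (each unordered edge once).
HasExactlyBridges : ∀ {n} → Graph n → ℕ → Set
HasExactlyBridges {n} G k =
  Σ (List (Fin n × Fin n)) λ L →
    length L ≡ k × Unique L
    × (∀ (u v : Fin n) → (u , v) ∈ L → u < v)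
    × (∀ (u v : Fin n) → u < v → (IsBridge G u v ⇔ ((u , v) ∈ L)))

-- Edge-colourings with colours Fin m (colour of edge {u,v} is c u v = c v u;
-- values on non-edges are irrelevant)
record EdgeColouring {n : ℕ} (G : Graph n) (m : ℕ) : Set where
  field
    colour : Fin n → Fin n → Fin m
    colour-sym : ∀ u v → colour u v ≡ colour v u

open EdgeColouring public

colours : ∀ {n m} {G : Graph n} (c : EdgeColouring G m) {u v} → Walk (Adj G) u v → List (Fin m)
colours c []                      = []
colours c (_∷_ {u} {w} _ rest) = colour c u w ∷ colours c rest

RainbowPath : ∀ {n m} {G : Graph n} → EdgeColouring G m → Fin n → Fin n → Set
RainbowPath {G = G} c u v =
  Σ (Walk (Adj G) u v) λ w → Unique (vertices w) × Unique (colours c w)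

RainbowConnected : ∀ {n m} {G : Graph n} → EdgeColouring G m → Set
RainbowConnected {n} c = ∀ (u v : Fin n) → u ≢ v → RainbowPath c u v

rc≤ : ∀ {n} → Graph n → ℕ → Set
rc≤ G i = Σ (EdgeColouring G i) RainbowConnected

module Submission where

-- Let ab be a bridge.  If both a and b had a further neighbour,
-- x of a and y of b, then x and y would be joined by a walk of length ≤ 2
-- avoiding ab, so ab would lie on a closed walk and not be a bridge; hence an
-- endpoint, say a, is pendant.  All other vertices are then at distance 2 from
-- a through b, so b is a universal vertex ("hub").  Every pendant vertex l of
-- G is attached to the hub and the edge lu is a bridge, so pendant vertices
-- can be labelled injectively by the k positions of the bridge list.  Let H be
-- G without the hub.  By Ore's lemma the vertices of H can be split into two
-- sides so that every non-isolated vertex of H has a neighbour on the other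
-- side.  Colour a spoke ux by the label of x when x is pendant and by one of
-- two extra colours recording the side of x otherwise, and every edge of H by
-- the colour of some label.  Two non-hub vertices are joined by the rainbow
-- path s-u-t unless both are non-pendant on the same side, in which case
-- s-y-u-t with y a neighbour of s in H on the other side is rainbow.

open import Defs
open import Data.Nat using (ℕ; zero; suc; _+_; _≥_; _≤_; s≤s)
open import Data.Fin using (Fin; zero; suc; _<_; _↑ˡ_; _↑ʳ_; splitAt; fromℕ<)
open import Data.Fin.Properties using (_≟_; any?; <-cmp; ↑ˡ-injective; ↑ʳ-injective; splitAt-↑ˡ; splitAt-↑ʳ)
open import Data.Bool using (Bool; true; false; not; _∧_)
open import Data.Bool.Properties using (not-involutive; not-¬) renaming (_≟_ to _≟ᵇ_)
open import Data.List using (List; []; _∷_; length; lookup)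
open import Data.List.Relation.Unary.All using ([]; _∷_)
open import Data.List.Relation.Unary.AllPairs using ([]; _∷_)
open import Data.List.Relation.Unary.Any using (index)
open import Data.List.Relation.Unary.Any.Properties using (lookup-index)
open import Data.List.Relation.Unary.Unique.Propositional using (Unique)
open import Data.List.Membership.Propositional using (_∈_)
open import Data.List.Membership.Propositional.Properties using (∈-lookup)
open import Data.Product using (Σ; ∃; _×_; _,_; proj₁; proj₂)
open import Data.Sum using (_⊎_; inj₁; inj₂)
open import Data.Empty using (⊥-elim)
open import Relation.Nullary using (¬_; Dec; yes; no)
open import Relation.Nullary.Decidable using (isYes; decidable-stable; _×-dec_; _⊎-dec_; ¬?)
open import Relation.Binary.PropositionalEquality
  using (_≡_; _≢_; refl; trans; cong; subst; ≢-sym) renaming (sym to ≡-sym)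
open import Relation.Binary.Definitions using (tri<; tri≈; tri>)
open import Function.Bundles using (Equivalence)

not-flip : ∀ {a b} → a ≡ not b → b ≡ not a
not-flip {b = b} refl = ≡-sym (not-involutive b)

≢-respect : ∀ {A : Set} {a b x y : A} → a ≡ x → b ≡ y → x ≢ y → a ≢ b
≢-respect refl refl x≢y = x≢y

module Palette (k : ℕ) where

  bridgeColour : Fin k → Fin (k + 2)
  bridgeColour i = i ↑ˡ 2

  sideColour : Bool → Fin (k + 2)
  sideColour true  = k ↑ʳ zero
  sideColour false = k ↑ʳ suc zero

  bridgeColour-injective : ∀ {i j} → bridgeColour i ≡ bridgeColour j → i ≡ j
  bridgeColour-injective = ↑ˡ-injective 2 _ _

  sideColour-injective : ∀ b b' → sideColour b ≡ sideColour b' → b ≡ b'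
  sideColour-injective true  true  _ = refl
  sideColour-injective false false _ = refl
  sideColour-injective true  false e with ↑ʳ-injective k zero (suc zero) e
  ... | ()
  sideColour-injective false true  e with ↑ʳ-injective k (suc zero) zero e
  ... | ()

  -- splitAt k tells the two kinds of colour apart.
  bridge≢side : ∀ i b → bridgeColour i ≢ sideColour b
  bridge≢side i true  e with trans (≡-sym (splitAt-↑ˡ k i 2)) (trans (cong (splitAt k) e) (splitAt-↑ʳ k 2 zero))
  ... | ()
  bridge≢side i false e with trans (≡-sym (splitAt-↑ˡ k i 2)) (trans (cong (splitAt k) e) (splitAt-↑ʳ k 2 (suc zero)))
  ... | ()

  -- The colours met on the path s - y - hub - t of the hub construction.
  detour-colours-distinct : ∀ i b → Unique (bridgeColour i ∷ sideColour (not b) ∷ sideColour b ∷ [])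
  detour-colours-distinct i b =
    (bridge≢side i (not b) ∷ bridge≢side i b ∷ [])
    ∷ ((λ e → not-¬ refl (≡-sym (sideColour-injective (not b) b e))) ∷ [])
    ∷ [] ∷ []

module _ {n : ℕ} {R : Fin n → Fin n → Set} where

  _++ʷ_ : ∀ {x y z} → Walk R x y → Walk R y z → Walk R x z
  []      ++ʷ w = w
  (e ∷ v) ++ʷ w = e ∷ (v ++ʷ w)

  reverseʷ : (∀ {x y} → R x y → R y x) → ∀ {x y} → Walk R x y → Walk R y x
  reverseʷ sym-R []      = []
  reverseʷ sym-R (e ∷ w) = reverseʷ sym-R w ++ʷ (sym-R e ∷ [])

  stuck-walk : ∀ {x v} → (∀ y → ¬ R x y) → Walk R x v → x ≡ v
  stuck-walk none []      = refl
  stuck-walk none (e ∷ _) = ⊥-elim (none _ e)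

module _ {n : ℕ} (G : Graph n) where

  adj-sym : ∀ {x y} → Adj G x y → Adj G y x
  adj-sym {x} {y} e = trans (sym G y x) e

  adj-≢ : ∀ {x y} → Adj G x y → x ≢ y
  adj-≢ {x} e refl with trans (≡-sym e) (irrefl G x)
  ... | ()

  adj? : ∀ x y → Dec (Adj G x y)
  adj? x y = adj G x y ≟ᵇ true

  HasNeighbour : Fin n → Set
  HasNeighbour x = ∃ λ y → Adj G x y

  hasNeighbour? : ∀ x → Dec (HasNeighbour x)
  hasNeighbour? x = any? (adj? x)

  Pendant : Fin n → Fin n → Set
  Pendant l u = Adj G l u × (∀ x → Adj G l x → x ≡ u)

  short-walk : ∀ {x y} (w : Walk (Adj G) x y) → walkLength w ≤ 2 →
               x ≡ y ⊎ Adj G x y ⊎ ∃ λ z → Adj G x z × Adj G z y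
  short-walk []                  _                 = inj₁ refl
  short-walk (e ∷ [])            _                 = inj₂ (inj₁ e)
  short-walk (e ∷ e' ∷ [])       _                 = inj₂ (inj₂ (_ , e , e'))
  short-walk (_ ∷ _ ∷ _ ∷ _) (s≤s (s≤s ()))

  close-by : Diameter G 2 → ∀ x y → x ≡ y ⊎ Adj G x y ⊎ ∃ λ z → Adj G x z × Adj G z y
  close-by (bounded , _) x y with bounded x y
  ... | _ , ((w , len) , _) , d≤2 = short-walk w (subst (_≤ 2) (≡-sym len) d≤2)

  sameEdge? : (x y a b : Fin n) → Dec (SameEdge x y a b)
  sameEdge? x y a b = ((x ≟ a) ×-dec (y ≟ b)) ⊎-dec ((x ≟ b) ×-dec (y ≟ a))

  minus-sym : ∀ {a b x y} → AdjMinus G a b x y → AdjMinus G a b y x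
  minus-sym (e , ¬same) = adj-sym e , λ { (inj₁ (p , q)) → ¬same (inj₂ (q , p))
                                          ; (inj₂ (p , q)) → ¬same (inj₁ (q , p)) }

  Outside : Fin n → Fin n → Fin n → Set
  Outside a b p = p ≢ a × p ≢ b

  keepˡ : ∀ {a b p q} → Adj G p q → Outside a b p → AdjMinus G a b p q
  keepˡ e (p≢a , p≢b) = e , λ { (inj₁ (p≡a , _)) → p≢a p≡a ; (inj₂ (p≡b , _)) → p≢b p≡b }

  keepʳ : ∀ {a b p q} → Adj G p q → Outside a b q → AdjMinus G a b p q
  keepʳ e (q≢a , q≢b) = e , λ { (inj₁ (_ , q≡b)) → q≢b q≡b ; (inj₂ (_ , q≡a)) → q≢a q≡a }

  bypass : ∀ {a b} → Walk (AdjMinus G a b) a b → ∀ {s t} → Walk (Adj G) s t → Walk (AdjMinus G a b) s t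
  bypass d [] = []
  bypass {a} {b} d {t = t} (_∷_ {s} {w} e rest) = reroute (sameEdge? s w a b) (bypass d rest)
    where
    reroute : Dec (SameEdge s w a b) → Walk (AdjMinus G a b) w t → Walk (AdjMinus G a b) s t
    reroute (yes (inj₁ (refl , refl))) r = d ++ʷ r
    reroute (yes (inj₂ (refl , refl))) r = reverseʷ minus-sym d ++ʷ r
    reroute (no ¬same)                 r = (e , ¬same) ∷ r

  cycle-not-bridge : Connected G → ∀ {a b} → Walk (AdjMinus G a b) a b → ConnectedRel (AdjMinus G a b)
  cycle-not-bridge conn d s t = bypass d (conn s t)

  pendant-or-branch : ∀ {a b} → Adj G a b → Pendant a b ⊎ ∃ λ x → Adj G a x × x ≢ b
  pendant-or-branch {a} {b} ab with any? (λ x → adj? a x ×-dec ¬? (x ≟ b))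
  ... | yes (x , ax , x≢b) = inj₂ (x , ax , x≢b)
  ... | no none = inj₁ (ab , λ x ax → decidable-stable (x ≟ b) (λ x≢b → none (x , ax , x≢b)))

  detour : Diameter G 2 → ∀ {a b x y} → Adj G a x → Outside a b x → Adj G y b → Outside a b y →
           Walk (AdjMinus G a b) a b
  detour diam {x = x} {y} ax ox yb oy with close-by diam x y
  ... | inj₁ refl                 = keepʳ ax ox ∷ keepˡ yb oy ∷ []
  ... | inj₂ (inj₁ xy)            = keepʳ ax ox ∷ keepˡ xy ox ∷ keepˡ yb oy ∷ []
  ... | inj₂ (inj₂ (_ , xz , zy)) = keepʳ ax ox ∷ keepˡ xz ox ∷ keepʳ zy oy ∷ keepˡ yb oy ∷ []

  -- One endpoint of a bridge is pendant, since otherwise `detour` closes a walk through it.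
  bridge-pendant : Connected G → Diameter G 2 → ∀ {a b} → IsBridge G a b → Pendant a b ⊎ Pendant b a
  bridge-pendant conn diam (ab , cut) with pendant-or-branch ab | pendant-or-branch (adj-sym ab)
  ... | inj₁ pa | _      = inj₁ pa
  ... | inj₂ _  | inj₁ pb = inj₂ pb
  ... | inj₂ (x , ax , x≢b) | inj₂ (y , by , y≢a) =
    ⊥-elim (cut (cycle-not-bridge conn (detour diam ax (≢-sym (adj-≢ ax) , x≢b) (adj-sym by) (y≢a , ≢-sym (adj-≢ by)))))

  -- In diameter 2, every vertex other than u is reached from a pendant l through u.
  pendant-hub : Diameter G 2 → ∀ {l u} → Pendant l u → ∀ w → w ≢ u → Adj G u w
  pendant-hub diam {l} {u} (lu , only) w w≢u with close-by diam l w
  ... | inj₁ refl                  = adj-sym lu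
  ... | inj₂ (inj₁ lw)             = ⊥-elim (w≢u (only w lw))
  ... | inj₂ (inj₂ (z , lz , zw)) = subst (λ z → Adj G z w) (only z lz) zw

  bridge-hub : Connected G → Diameter G 2 → ∀ {a b} → IsBridge G a b → ∃ λ u → ∀ w → w ≢ u → Adj G u w
  bridge-hub conn diam {a} {b} br with bridge-pendant conn diam br
  ... | inj₁ pa = b , pendant-hub diam pa
  ... | inj₂ pb = a , pendant-hub diam pb

  pendant-bridge : ∀ {l u a b} → Pendant l u → SameEdge l u a b → Adj G a b → IsBridge G a b
  pendant-bridge {l} {u} {a} {b} (lu , only) same ab = ab , λ conn → adj-≢ lu (stuck-walk isolated (conn l u))
    where
    isolated : ∀ y → ¬ AdjMinus G a b l y
    isolated y (ly , ¬same) = ¬same (subst (λ y → SameEdge l y a b) (≡-sym (only y ly)) same)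

module BridgeList {n : ℕ} (G : Graph n) (L : List (Fin n × Fin n))
                  (listed : ∀ p q → p < q → IsBridge G p q → (p , q) ∈ L) where

  Touches : Fin n → Fin n → Fin n × Fin n → Set
  Touches l u e = e ≡ (l , u) ⊎ e ≡ (u , l)

  touches-unique : ∀ {l l' u e} → l ≢ u → l' ≢ u → Touches l u e → Touches l' u e → l ≡ l'
  touches-unique _   _    (inj₁ refl) (inj₁ e) = cong proj₁ e
  touches-unique l≢u _    (inj₁ refl) (inj₂ e) = ⊥-elim (l≢u (cong proj₁ e))
  touches-unique _   l'≢u (inj₂ refl) (inj₁ e) = ⊥-elim (l'≢u (≡-sym (cong proj₁ e)))
  touches-unique _   _    (inj₂ refl) (inj₂ e) = cong proj₂ e

  -- A pendant edge is a bridge, hence occurs in L in its increasing orientation.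
  pendant-position : ∀ {l u} → Pendant G l u → Σ (Fin (length L)) λ i → Touches l u (lookup L i)
  pendant-position {l} {u} p@(lu , _) with <-cmp l u
  ... | tri< l<u _ _ = let mem = listed l u l<u (pendant-bridge G p (inj₁ (refl , refl)) lu)
                       in index mem , inj₁ (≡-sym (lookup-index mem))
  ... | tri≈ _ l≡u _ = ⊥-elim (adj-≢ G lu l≡u)
  ... | tri> _ _ u<l = let mem = listed u l u<l (pendant-bridge G p (inj₂ (refl , refl)) (adj-sym G lu))
                       in index mem , inj₂ (≡-sym (lookup-index mem))

  pendant-label : ∀ {l u} → Pendant G l u → Fin (length L)
  pendant-label p = proj₁ (pendant-position p)

  pendant-label-injective : ∀ {l l' u} (p : Pendant G l u) (p' : Pendant G l' u) →
                            pendant-label p ≡ pendant-label p' → l ≡ l'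
  pendant-label-injective p@(lu , _) p'@(l'u , _) same =
    touches-unique (adj-≢ G lu) (adj-≢ G l'u) (proj₂ (pendant-position p))
      (subst (λ i → Touches _ _ (lookup L i)) (≡-sym same) (proj₂ (pendant-position p')))

Opposite : ∀ {n} → Graph n → (Fin n → Bool) → Set
Opposite G side = ∀ x → HasNeighbour G x → ∃ λ y → Adj G x y × side y ≡ not (side x)

dropFirst : ∀ {n} → Graph (suc n) → Graph n
dropFirst G = record { adj    = λ i j → adj G (suc i) (suc j)
                     ; sym    = λ i j → sym G (suc i) (suc j)
                     ; irrefl = λ i → irrefl G (suc i) }

opposite-sides : ∀ {n} (G : Graph n) → Σ (Fin n → Bool) (Opposite G)
opposite-sides {zero}  G = (λ ()) , λ ()
opposite-sides {suc n} G = side , opposite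
  where
  G⁻ : Graph n
  G⁻ = dropFirst G
  side⁻ : Fin n → Bool
  side⁻ = proj₁ (opposite-sides G⁻)

  -- The first vertex is put opposite to the old side of one of its neighbours.
  root : Σ Bool λ b → HasNeighbour G zero → ∃ λ j → Adj G zero (suc j) × b ≡ not (side⁻ j)
  root with any? (λ j → adj? G zero (suc j))
  ... | yes (j , a) = not (side⁻ j) , λ _ → j , a , refl
  ... | no none     = true , λ { (zero , a) → ⊥-elim (adj-≢ G a refl) ; (suc j , a) → ⊥-elim (none (j , a)) }

  -- Vertices isolated in G⁻ can only see the first vertex and face it.
  side : Fin (suc n) → Bool
  side zero = proj₁ root
  side (suc i) with hasNeighbour? G⁻ i
  ... | yes _ = side⁻ i
  ... | no _  = not (proj₁ root)

  kept : ∀ i → HasNeighbour G⁻ i → side (suc i) ≡ side⁻ i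
  kept i nb with hasNeighbour? G⁻ i
  ... | yes _ = refl
  ... | no ¬nb = ⊥-elim (¬nb nb)

  facing : ∀ i → side⁻ i ≡ not (side zero) → side (suc i) ≡ not (side zero)
  facing i s with hasNeighbour? G⁻ i
  ... | yes _ = s
  ... | no _  = refl

  opposite : Opposite G side
  opposite zero nb with proj₂ root nb
  ... | j , a , b≡ = suc j , a , facing j (not-flip b≡)
  opposite (suc i) nb with hasNeighbour? G⁻ i | nb
  ... | yes nb⁻ | _ with proj₂ (opposite-sides G⁻) i nb⁻
  ...   | j , a , s = suc j , a , trans (kept j (i , adj-sym G⁻ a)) s
  opposite (suc i) nb | no _   | (zero , a)  = zero , a , ≡-sym (not-involutive _)
  opposite (suc i) nb | no ¬nb | (suc j , a) = ⊥-elim (¬nb (j , a))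

∧-true : ∀ {a b} → a ∧ b ≡ true → a ≡ true × b ≡ true
∧-true {true} {true} _ = refl , refl

module _ {n : ℕ} (G : Graph n) (u : Fin n) where

  -- The test "x is not u" is opaque, so that case analyses on x ≟ u in
  -- statements about the hub do not reach inside the adjacency of deleteHub.
  opaque
    away : Fin n → Bool
    away x = not (isYes (x ≟ u))

    away-hub : away u ≡ false
    away-hub with u ≟ u
    ... | yes _  = refl
    ... | no u≢u = ⊥-elim (u≢u refl)

    away-other : ∀ {x} → x ≢ u → away x ≡ true
    away-other {x} x≢u with x ≟ u
    ... | yes x≡u = ⊥-elim (x≢u x≡u)
    ... | no _    = refl

  private
    away-sym : ∀ x y → away x ∧ away y ∧ adj G x y ≡ away y ∧ away x ∧ adj G y x
    away-sym x y rewrite sym G x y with away x | away y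
    ... | false | false = refl
    ... | false | true  = refl
    ... | true  | false = refl
    ... | true  | true  = refl

    away-irrefl : ∀ x → away x ∧ away x ∧ adj G x x ≡ false
    away-irrefl x rewrite irrefl G x with away x
    ... | false = refl
    ... | true  = refl

  deleteHub : Graph n
  deleteHub = record { adj = λ x y → away x ∧ away y ∧ adj G x y ; sym = away-sym ; irrefl = away-irrefl }

  deleteHub-adj : ∀ {x y} → Adj deleteHub x y → Adj G x y × x ≢ u × y ≢ u
  deleteHub-adj {x} {y} e = xy , not-hub x-away , not-hub y-away
    where
    x-away : away x ≡ true
    x-away = proj₁ (∧-true {away x} e)
    y-away : away y ≡ true
    y-away = proj₁ (∧-true {away y} (proj₂ (∧-true {away x} e)))
    xy : Adj G x y
    xy = proj₂ (∧-true {away y} (proj₂ (∧-true {away x} e)))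
    not-hub : ∀ {z} → away z ≡ true → z ≢ u
    not-hub z-away refl with trans (≡-sym z-away) away-hub
    ... | ()

  deleteHub-intro : ∀ {x y} → Adj G x y → x ≢ u → y ≢ u → Adj deleteHub x y
  deleteHub-intro e x≢u y≢u rewrite away-other x≢u | away-other y≢u = e

module _ {n m : ℕ} {G : Graph n} (c : EdgeColouring G m) where

  rainbow-edge : ∀ {s t} → Adj G s t → s ≢ t → RainbowPath c s t
  rainbow-edge st s≢t = (st ∷ []) , ((s≢t ∷ []) ∷ [] ∷ []) , ([] ∷ [])

  rainbow-two : ∀ {s w t} → Adj G s w → Adj G w t → s ≢ w → s ≢ t → w ≢ t →
                colour c s w ≢ colour c w t → RainbowPath c s t
  rainbow-two sw wt s≢w s≢t w≢t c≢ =
    (sw ∷ wt ∷ []) , ((s≢w ∷ s≢t ∷ []) ∷ (w≢t ∷ []) ∷ [] ∷ []) , ((c≢ ∷ []) ∷ [] ∷ [])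

-- A graph with a hub u whose pendant vertices carry injective labels in
-- Fin k has a rainbow colouring with k + 2 colours (given k ≥ 1, i.e. a
-- label `spare` available for the edges away from the hub).

module HubColouring {n k : ℕ} (G : Graph n) (u : Fin n)
  (universal : ∀ w → w ≢ u → Adj G u w)
  (label : ∀ {l} → Pendant G l u → Fin k)
  (label-injective : ∀ {l l'} (p : Pendant G l u) (p' : Pendant G l' u) → label p ≡ label p' → l ≡ l')
  (spare : Fin k) where

  open Palette k

  H : Graph n
  H = deleteHub G u

  side : Fin n → Bool
  side = proj₁ (opposite-sides H)

  opposite : Opposite H side
  opposite = proj₂ (opposite-sides H)

  lonely : ∀ x → ¬ HasNeighbour H x → x ≢ u → Pendant G x u
  lonely x ¬nb x≢u = adj-sym G (universal x x≢u) ,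
    λ y xy → decidable-stable (y ≟ u) (λ y≢u → ¬nb (y , deleteHub-intro G u xy x≢u y≢u))

  -- Colour of the spoke ux, from the two decisions it depends on (its value
  -- at x = u is never used).
  spokeFrom : ∀ x → Dec (HasNeighbour H x) → Dec (x ≡ u) → Fin (k + 2)
  spokeFrom x (yes _)  _          = sideColour (side x)
  spokeFrom x (no ¬nb) (no x≢u)   = bridgeColour (label (lonely x ¬nb x≢u))
  spokeFrom x (no _)   (yes _)    = bridgeColour spare

  spoke : Fin n → Fin (k + 2)
  spoke x = spokeFrom x (hasNeighbour? H x) (x ≟ u)

  spoke-inner : ∀ {x} → HasNeighbour H x → spoke x ≡ sideColour (side x)
  spoke-inner {x} nb with hasNeighbour? H x
  ... | yes _  = refl
  ... | no ¬nb = ⊥-elim (¬nb nb)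

  SpokeKind : Fin n → Set
  SpokeKind x = (HasNeighbour H x × spoke x ≡ sideColour (side x))
              ⊎ Σ (Pendant G x u) λ p → spoke x ≡ bridgeColour (label p)

  spoke-kind : ∀ x → x ≢ u → SpokeKind x
  spoke-kind x x≢u = kind (hasNeighbour? H x) (x ≟ u)
    where
    kind : (d : Dec (HasNeighbour H x)) (e : Dec (x ≡ u)) →
           (HasNeighbour H x × spokeFrom x d e ≡ sideColour (side x))
           ⊎ Σ (Pendant G x u) λ p → spokeFrom x d e ≡ bridgeColour (label p)
    kind (yes nb)  _          = inj₁ (nb , refl)
    kind (no ¬nb)  (no x≢u')  = inj₂ (lonely x ¬nb x≢u' , refl)
    kind (no _)    (yes x≡u)  = ⊥-elim (x≢u x≡u)

  hubColourFrom : ∀ x y → Dec (x ≡ u) → Dec (y ≡ u) → Fin (k + 2)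
  hubColourFrom x y (yes _) _       = spoke y
  hubColourFrom x y (no _)  (yes _) = spoke x
  hubColourFrom x y (no _)  (no _)  = bridgeColour spare

  hubColour : Fin n → Fin n → Fin (k + 2)
  hubColour x y = hubColourFrom x y (x ≟ u) (y ≟ u)

  hubColourFrom-sym : ∀ x y (d : Dec (x ≡ u)) (e : Dec (y ≡ u)) → hubColourFrom x y d e ≡ hubColourFrom y x e d
  hubColourFrom-sym _ _ (yes refl) (yes refl) = refl
  hubColourFrom-sym _ _ (yes _)    (no _)     = refl
  hubColourFrom-sym _ _ (no _)     (yes _)    = refl
  hubColourFrom-sym _ _ (no _)     (no _)     = refl

  colouring : EdgeColouring G (k + 2)
  colouring = record { colour = hubColour ; colour-sym = λ x y → hubColourFrom-sym x y (x ≟ u) (y ≟ u) }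

  from-hub : ∀ y → hubColour u y ≡ spoke y
  from-hub y = at (u ≟ u) (y ≟ u)
    where
    at : (d : Dec (u ≡ u)) (e : Dec (y ≡ u)) → hubColourFrom u y d e ≡ spoke y
    at (yes _)  _ = refl
    at (no u≢u) _ = ⊥-elim (u≢u refl)

  to-hub : ∀ {x} → x ≢ u → hubColour x u ≡ spoke x
  to-hub {x} x≢u = at (x ≟ u) (u ≟ u)
    where
    at : (d : Dec (x ≡ u)) (e : Dec (u ≡ u)) → hubColourFrom x u d e ≡ spoke x
    at (yes x≡u) _        = ⊥-elim (x≢u x≡u)
    at (no _)    (yes _)  = refl
    at (no _)    (no u≢u) = ⊥-elim (u≢u refl)

  off-hub : ∀ {x y} → x ≢ u → y ≢ u → hubColour x y ≡ bridgeColour spare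
  off-hub {x} {y} x≢u y≢u = at (x ≟ u) (y ≟ u)
    where
    at : (d : Dec (x ≡ u)) (e : Dec (y ≡ u)) → hubColourFrom x y d e ≡ bridgeColour spare
    at (yes x≡u) _         = ⊥-elim (x≢u x≡u)
    at (no _)    (yes y≡u) = ⊥-elim (y≢u y≡u)
    at (no _)    (no _)    = refl

  through-hub : ∀ {s t} → s ≢ u → t ≢ u → s ≢ t → spoke s ≢ spoke t → RainbowPath colouring s t
  through-hub {s} {t} s≢u t≢u s≢t differ =
    rainbow-two colouring (adj-sym G (universal s s≢u)) (universal t t≢u) s≢u s≢t (≢-sym t≢u)
      (≢-respect (to-hub s≢u) (from-hub t) differ)

  -- Two vertices on the same side: go s - y - u - t with y an H-neighbour of s on the other side.
  around : ∀ {s t} → s ≢ t → HasNeighbour H s → HasNeighbour H t → side s ≡ side t → RainbowPath colouring s t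
  around {s} {t} s≢t nbs nbt same with opposite s nbs
  ... | y , sy⁻ , side-y = (sy ∷ adj-sym G (universal y y≢u) ∷ universal t t≢u ∷ []) , distinct-vertices , distinct-colours
    where
    sy : Adj G s y
    sy = proj₁ (deleteHub-adj G u sy⁻)
    s≢u : s ≢ u
    s≢u = proj₁ (proj₂ (deleteHub-adj G u sy⁻))
    y≢u : y ≢ u
    y≢u = proj₂ (proj₂ (deleteHub-adj G u sy⁻))
    t≢u : t ≢ u
    t≢u = proj₁ (proj₂ (deleteHub-adj G u (proj₂ nbt)))
    side-y-t : side y ≡ not (side t)
    side-y-t = trans side-y (cong not same)
    y≢t : y ≢ t
    y≢t y≡t = not-¬ refl (trans (≡-sym (cong side y≡t)) side-y-t)
    distinct-vertices : Unique (s ∷ y ∷ u ∷ t ∷ [])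
    distinct-vertices = (adj-≢ G sy ∷ s≢u ∷ s≢t ∷ []) ∷ (y≢u ∷ y≢t ∷ []) ∷ (≢-sym t≢u ∷ []) ∷ [] ∷ []
    distinct-colours : Unique (hubColour s y ∷ hubColour y u ∷ hubColour u t ∷ [])
    distinct-colours rewrite off-hub s≢u y≢u | to-hub y≢u | spoke-inner (s , adj-sym H sy⁻)
                           | from-hub t | spoke-inner nbt | side-y-t = detour-colours-distinct spare (side t)

  rainbow-connected : RainbowConnected colouring
  rainbow-connected s t s≢t with s ≟ u | t ≟ u
  ... | yes refl | _        = rainbow-edge colouring (universal t (≢-sym s≢t)) s≢t
  ... | no s≢u   | yes refl = rainbow-edge colouring (adj-sym G (universal s s≢u)) s≢t
  ... | no s≢u   | no t≢u with spoke-kind s s≢u | spoke-kind t t≢u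
  ...   | inj₂ (p , es) | inj₂ (q , et) =
          through-hub s≢u t≢u s≢t (≢-respect es et λ e → s≢t (label-injective p q (bridgeColour-injective e)))
  ...   | inj₂ (p , es) | inj₁ (_ , et) = through-hub s≢u t≢u s≢t (≢-respect es et (bridge≢side (label p) (side t)))
  ...   | inj₁ (_ , es) | inj₂ (q , et) = through-hub s≢u t≢u s≢t (≢-sym (≢-respect et es (bridge≢side (label q) (side s))))
  ...   | inj₁ (nbs , es) | inj₁ (nbt , et) with side s ≟ᵇ side t
  ...     | yes same  = around s≢t nbs nbt same
  ...     | no differ = through-hub s≢u t≢u s≢t (≢-respect es et λ e → differ (sideColour-injective (side s) (side t) e))

  hub-rc : rc≤ G (k + 2)
  hub-rc = colouring , rainbow-connected

theorem7 : ∀ {n : ℕ} (G : Graph n) (k : ℕ) →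
           Connected G → Diameter G 2 → k ≥ 1 → HasExactlyBridges G k →
           rc≤ G (k + 2)
theorem7 {n} G _ conn diam k≥1 (L , refl , _ , ordered , exact) =
  HubColouring.hub-rc G hub universal pendant-label pendant-label-injective (fromℕ< k≥1)
  where
  listed : ∀ p q → p < q → IsBridge G p q → (p , q) ∈ L
  listed p q p<q = Equivalence.to (exact p q p<q)
  open BridgeList G L listed
  some-bridge : IsBridge G (proj₁ (lookup L (fromℕ< k≥1))) (proj₂ (lookup L (fromℕ< k≥1)))
  some-bridge = Equivalence.from (exact _ _ (ordered _ _ (∈-lookup (fromℕ< k≥1)))) (∈-lookup (fromℕ< k≥1))
  hub : Fin n
  hub = proj₁ (bridge-hub G conn diam some-bridge)
  universal : ∀ w → w ≢ hub → Adj G hub w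
  universal = proj₂ (bridge-hub G conn diam some-bridge)
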